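{- Let $G=(V,E)$ be a DAG with topological order $v_1,\ldots,v_{|V|}$, and for $i\in\{0,\ldots,|V|\}$ let $G_i=G[\{v_1,\ldots,v_i\}]$ (with $G_0$ the empty graph). For every $i\in\{1,\ldots,|V|\}$, if $A$ is a $G_{i-1}$-frontier antichain such that no vertex of $A$ reaches $v_i$, then $A\cup\{v_i\}$ is a $G_i$-frontier antichain.
   Context: A topological order is an ordering of the vertices such that every edge goes from an earlier to a later vertex. In a directed graph $H$, $u$ reaches $v$ if there is a path (sequence of distinct vertices, consecutive ones joined by edges of $H$, at least one vertex) from $u$ to $v$ in $H$. An antichain of $H$ is a set of vertices no one of which reaches a different one in $H$ (the empty set is an antichain). A set $A$ reaches $v$ if some $u\in A$ reaches $v$. For antichains $A,B$ of $H$ of the same size, $B$ dominates $A$ (in $H$) if for every $b\in B$, $A$ reaches $b$ in $H$; antichains of different sizes are not related. An antichain of $H$ is an $H$-frontier antichain if it is not dominated in $H$ by any other antichain of $H$. -}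

module Defs where

open import Data.Nat using (ℕ; suc; _<_)
open import Data.Fin using (Fin; toℕ)
open import Data.Fin.Subset using (Subset; _∈_; ∣_∣)
open import Data.List using (List; []; _∷_)
open import Data.List.Relation.Unary.Unique.Propositional using (Unique)
open import Data.Product using (Σ; ∃; _×_)
open import Data.Unit using (⊤)
open import Relation.Nullary using (¬_)
open import Relation.Binary.PropositionalEquality using (_≡_; _≢_)
open import Function.Definitions using (Bijective)

Graph : ℕ → Set₁
Graph n = Fin n → Fin n → Set

-- A "subgraph" H of G is described by its vertex predicate S; edges of H are
-- the edges of G between vertices of S (induced subgraph G[S]).
VSet : ℕ → Set₁
VSet n = Fin n → Set

data Walk {n : ℕ} (E : Graph n) (S : VSet n) : Fin n → Fin n → List (Fin n) → Set where
  single : ∀ {u} → S u → Walk E S u u (u ∷ [])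
  step   : ∀ {u w v p} → S u → E u w → Walk E S w v p → Walk E S u v (u ∷ p)

Reaches : {n : ℕ} → Graph n → VSet n → Fin n → Fin n → Set
Reaches E S u v = Σ (List _) λ p → Walk E S u v p × Unique p

SetReaches : {n : ℕ} → Graph n → VSet n → Subset n → Fin n → Set
SetReaches E S A v = ∃ λ u → u ∈ A × Reaches E S u v

Antichain : {n : ℕ} → Graph n → VSet n → Subset n → Set
Antichain E S A =
  (∀ x → x ∈ A → S x) ×
  (∀ x y → x ∈ A → y ∈ A → x ≢ y → ¬ Reaches E S x y)

Dominates : {n : ℕ} → Graph n → VSet n → Subset n → Subset n → Set
Dominates E S B A = ∣ B ∣ ≡ ∣ A ∣ × (∀ b → b ∈ B → SetReaches E S A b)

Frontier : {n : ℕ} → Graph n → VSet n → Subset n → Set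
Frontier E S A =
  Antichain E S A ×
  (∀ B → Antichain E S B → B ≢ A → ¬ Dominates E S B A)

IsTopOrder : {n : ℕ} → Graph n → (Fin n → Fin n) → Set
IsTopOrder E vtx = Bijective _≡_ _≡_ vtx × (∀ i j → E (vtx i) (vtx j) → toℕ i < toℕ j)

-- Vertex set of G_k = G[{v_1,…,v_k}] (positions 0,…,k-1 in 0-based indexing).
Prefix : {n : ℕ} → (Fin n → Fin n) → ℕ → VSet n
Prefix vtx k v = ∃ λ j → vtx j ≡ v × toℕ j < k

-- Since v_i comes last in the topological order, it is a sink of G_i and
-- every G_i-path ending elsewhere stays inside G_{i-1}.  So A ∪ {v_i} is an
-- antichain, and an antichain B dominating it yields, after removing v_i (or
-- any vertex, if v_i ∉ B), an antichain of G_{i-1} dominating A.  As A is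
-- frontier that antichain is A itself, which either gives B = A ∪ {v_i} or
-- makes B contain a vertex of A together with a vertex that A reaches.
module Submission where

open import Defs
open import Data.Nat using (ℕ; suc; s≤s)
open import Data.Nat.Properties using (≤∧≢⇒<; <-irrefl; ≤-trans; n<1+n; m<n⇒m<1+n; suc-injective)
open import Data.Bool.Properties using () renaming (_≟_ to _≟ᵇ_)
open import Data.Fin using (Fin; toℕ; zero; suc)
open import Data.Fin.Properties using (toℕ-injective)
open import Data.Fin.Subset using (Subset; _∈_; _∉_; _∪_; ⁅_⁆; _-_; ∣_∣; inside; outside; Nonempty)
open import Data.Fin.Subset.Properties using (x∈p∪q⁻; x∈⁅y⁆⇒x≡y; p─q⊆p; ∪-identityʳ; p─⊥≡p; _∈?_; nonempty?; Empty-unique; ∣⊥∣≡0)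
open import Data.Vec using (_∷_; here; there)
open import Data.Vec.Properties using (≡-dec)
open import Data.Product using (_,_; proj₁; proj₂)
open import Data.Sum using (_⊎_; inj₁; inj₂)
open import Data.Empty using (⊥-elim)
open import Function using (_∘_)
open import Relation.Nullary using (¬_; yes; no)
open import Relation.Binary.PropositionalEquality using (_≡_; _≢_; refl; sym; trans; cong; subst; module ≡-Reasoning)

private
  variable
    n : ℕ
    E : Graph n
    S S′ : VSet n

x∈p-y⇒x≢y : ∀ (p : Subset n) {x y} → x ∈ p - y → x ≢ y
x∈p-y⇒x≢y (_ ∷ p) {suc x} {suc y} (there x∈) refl = x∈p-y⇒x≢y p x∈ refl
x∈p-y⇒x≢y (_ ∷ p) {zero}  {zero}  ()

x∈p-y⇒x∈p : ∀ (p : Subset n) {x y} → x ∈ p - y → x ∈ p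
x∈p-y⇒x∈p p {y = y} = p─q⊆p p ⁅ y ⁆

∣p∪⁅x⁆∣≡1+∣p∣ : ∀ (p : Subset n) {x} → x ∉ p → ∣ p ∪ ⁅ x ⁆ ∣ ≡ suc ∣ p ∣
∣p∪⁅x⁆∣≡1+∣p∣ (inside  ∷ p) {zero}  x∉ = ⊥-elim (x∉ here)
∣p∪⁅x⁆∣≡1+∣p∣ (outside ∷ p) {zero}  x∉ = cong (suc ∘ ∣_∣) (∪-identityʳ p)
∣p∪⁅x⁆∣≡1+∣p∣ (inside  ∷ p) {suc x} x∉ = cong suc (∣p∪⁅x⁆∣≡1+∣p∣ p (x∉ ∘ there))
∣p∪⁅x⁆∣≡1+∣p∣ (outside ∷ p) {suc x} x∉ = ∣p∪⁅x⁆∣≡1+∣p∣ p (x∉ ∘ there)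

1+∣p-x∣≡∣p∣ : ∀ (p : Subset n) {x} → x ∈ p → suc ∣ p - x ∣ ≡ ∣ p ∣
1+∣p-x∣≡∣p∣ (inside  ∷ p) here      = cong (suc ∘ ∣_∣) (p─⊥≡p p)
1+∣p-x∣≡∣p∣ (inside  ∷ p) (there x∈) = cong suc (1+∣p-x∣≡∣p∣ p x∈)
1+∣p-x∣≡∣p∣ (outside ∷ p) (there x∈) = 1+∣p-x∣≡∣p∣ p x∈

p-x∪⁅x⁆≡p : ∀ (p : Subset n) {x} → x ∈ p → (p - x) ∪ ⁅ x ⁆ ≡ p
p-x∪⁅x⁆≡p (inside  ∷ p) here       = cong (inside ∷_) (trans (∪-identityʳ _) (p─⊥≡p p))
p-x∪⁅x⁆≡p (inside  ∷ p) (there x∈) = cong (inside ∷_) (p-x∪⁅x⁆≡p p x∈)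
p-x∪⁅x⁆≡p (outside ∷ p) (there x∈) = cong (outside ∷_) (p-x∪⁅x⁆≡p p x∈)

x∈p∪⁅y⁆⁻ : ∀ (p : Subset n) {x} y → x ∈ p ∪ ⁅ y ⁆ → x ∈ p ⊎ x ≡ y
x∈p∪⁅y⁆⁻ p y x∈ with x∈p∪q⁻ p ⁅ y ⁆ x∈
... | inj₁ x∈p = inj₁ x∈p
... | inj₂ x∈y = inj₂ (x∈⁅y⁆⇒x≡y y x∈y)

∣p∣≡1+k⇒Nonempty : ∀ (p : Subset n) {k} → ∣ p ∣ ≡ suc k → Nonempty p
∣p∣≡1+k⇒Nonempty {n} p ∣p∣≡1+k with nonempty? p
... | yes ne  = ne
... | no  ¬ne with () ← trans (sym (∣⊥∣≡0 n)) (trans (cong ∣_∣ (sym (Empty-unique ¬ne))) ∣p∣≡1+k)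

walk-head : ∀ {u w p} → Walk E S u w p → S u
walk-head (single u∈) = u∈
walk-head (step u∈ _ _) = u∈

Walk-mono : (∀ {x} → S x → S′ x) → ∀ {u w p} → Walk E S u w p → Walk E S′ u w p
Walk-mono S⊆S′ (single u∈)      = single (S⊆S′ u∈)
Walk-mono S⊆S′ (step u∈ uw wlk) = step (S⊆S′ u∈) uw (Walk-mono S⊆S′ wlk)

Reaches-mono : (∀ {x} → S x → S′ x) → ∀ {u w} → Reaches E S u w → Reaches E S′ u w
Reaches-mono S⊆S′ (p , wlk , uniq) = p , Walk-mono S⊆S′ wlk , uniq

Frontier⇒dominating≡ : ∀ {A B} → Frontier E S A → Antichain E S B → Dominates E S B A → B ≡ A
Frontier⇒dominating≡ {A = A} {B} (_ , undominated) antiB dom with ≡-dec _≟ᵇ_ B A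
... | yes B≡A = B≡A
... | no  B≢A = ⊥-elim (undominated B antiB B≢A dom)

record SinkExtension (E : Graph n) (S S′ : VSet n) (v : Fin n) : Set where
  field
    extend   : ∀ {x} → S x → S′ x
    sink∈    : S′ v
    sink∉    : ¬ S v
    restrict : ∀ {x} → S′ x → x ≢ v → S x
    no-out   : ∀ {w} → E v w → ¬ S′ w

module _ {S S′ : VSet n} {v : Fin n} (ext : SinkExtension E S S′ v) where
  open SinkExtension ext

  Walk-restrict : ∀ {u w p} → Walk E S′ u w p → w ≢ v → Walk E S u w p
  Walk-restrict (single u∈) w≢v = single (restrict u∈ w≢v)
  Walk-restrict (step u∈ uw wlk) w≢v =
    step (restrict u∈ λ { refl → no-out uw (walk-head wlk) }) uw (Walk-restrict wlk w≢v)

  Reaches-restrict : ∀ {u w} → Reaches E S′ u w → w ≢ v → Reaches E S u w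
  Reaches-restrict (p , wlk , uniq) w≢v = p , Walk-restrict wlk w≢v , uniq

  reaches-from-sink : ∀ {w} → Reaches E S′ v w → w ≡ v
  reaches-from-sink (_ , single _ , _)      = refl
  reaches-from-sink (_ , step _ vw wlk , _) = ⊥-elim (no-out vw (walk-head wlk))

  SetReaches-restrict : ∀ {A b} → SetReaches E S′ (A ∪ ⁅ v ⁆) b → b ≢ v → SetReaches E S A b
  SetReaches-restrict {A} (u , u∈ , u→b) b≢v with x∈p∪⁅y⁆⁻ A v u∈
  ... | inj₁ u∈A = u , u∈A , Reaches-restrict u→b b≢v
  ... | inj₂ refl = ⊥-elim (b≢v (reaches-from-sink u→b))

  Antichain-extend : ∀ {A} → Antichain E S A → (∀ a → a ∈ A → ¬ Reaches E S′ a v) →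
                     Antichain E S′ (A ∪ ⁅ v ⁆)
  Antichain-extend {A} (A⊆S , incomparable) A↛v = A∪v⊆S′ , incomparable′
    where
    A∪v⊆S′ : ∀ x → x ∈ A ∪ ⁅ v ⁆ → S′ x
    A∪v⊆S′ x x∈ with x∈p∪⁅y⁆⁻ A v x∈
    ... | inj₁ x∈A = extend (A⊆S x x∈A)
    ... | inj₂ refl = sink∈

    incomparable′ : ∀ x y → x ∈ A ∪ ⁅ v ⁆ → y ∈ A ∪ ⁅ v ⁆ → x ≢ y → ¬ Reaches E S′ x y
    incomparable′ x y x∈ y∈ x≢y x→y with x∈p∪⁅y⁆⁻ A v x∈ | x∈p∪⁅y⁆⁻ A v y∈
    ... | inj₂ refl | _         = x≢y (sym (reaches-from-sink x→y))
    ... | inj₁ x∈A  | inj₂ refl = A↛v x x∈A x→y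
    ... | inj₁ x∈A  | inj₁ y∈A  =
      incomparable x y x∈A y∈A x≢y (Reaches-restrict x→y λ { refl → sink∉ (A⊆S y y∈A) })

  Antichain-remove : ∀ {B x} → Antichain E S′ B → (∀ b → b ∈ B - x → b ≢ v) → Antichain E S (B - x)
  Antichain-remove {B} (B⊆S′ , incomparable) B-x≢v =
    (λ b b∈ → restrict (B⊆S′ b (x∈p-y⇒x∈p B b∈)) (B-x≢v b b∈)) ,
    (λ b c b∈ c∈ b≢c b→c →
      incomparable b c (x∈p-y⇒x∈p B b∈) (x∈p-y⇒x∈p B c∈) b≢c (Reaches-mono extend b→c))

  Dominates-remove : ∀ {A B x} → v ∉ A → x ∈ B → (∀ b → b ∈ B - x → b ≢ v) →
                     Dominates E S′ B (A ∪ ⁅ v ⁆) → Dominates E S (B - x) A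
  Dominates-remove {A} {B} {x} v∉A x∈B B-x≢v (∣B∣≡ , reached) = ∣B-x∣≡∣A∣ , reached′
    where
    open ≡-Reasoning
    ∣B-x∣≡∣A∣ : ∣ B - x ∣ ≡ ∣ A ∣
    ∣B-x∣≡∣A∣ = suc-injective (begin
      suc ∣ B - x ∣      ≡⟨ 1+∣p-x∣≡∣p∣ B x∈B ⟩
      ∣ B ∣              ≡⟨ ∣B∣≡ ⟩
      ∣ A ∪ ⁅ v ⁆ ∣      ≡⟨ ∣p∪⁅x⁆∣≡1+∣p∣ A v∉A ⟩
      suc ∣ A ∣          ∎)
    reached′ : ∀ b → b ∈ B - x → SetReaches E S A b
    reached′ b b∈ = SetReaches-restrict (reached b (x∈p-y⇒x∈p B b∈)) (B-x≢v b b∈)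

  module _ {A : Subset n} (frontier : Frontier E S A) where
    v∉A : v ∉ A
    v∉A v∈A = sink∉ (proj₁ (proj₁ frontier) v v∈A)

    -- Otherwise removing any x ∈ B would leave A, and x would be reached
    -- from the rest of B.
    dominator-contains-sink : ∀ {B} → Antichain E S′ B → Dominates E S′ B (A ∪ ⁅ v ⁆) → v ∈ B
    dominator-contains-sink {B} antiB dom with v ∈? B
    ... | yes v∈B = v∈B
    ... | no  v∉B with ∣p∣≡1+k⇒Nonempty B (trans (proj₁ dom) (∣p∪⁅x⁆∣≡1+∣p∣ A v∉A))
    ...   | x , x∈B with SetReaches-restrict (proj₂ dom x x∈B) (λ { refl → v∉B x∈B })
    ...     | a , a∈A , a→x =
      ⊥-elim (proj₂ antiB a x a∈B x∈B (x∈p-y⇒x≢y B a∈B-x) (Reaches-mono extend a→x))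
      where
      B-x≢v : ∀ b → b ∈ B - x → b ≢ v
      B-x≢v b b∈ refl = v∉B (x∈p-y⇒x∈p B b∈)

      B-x≡A : B - x ≡ A
      B-x≡A = Frontier⇒dominating≡ frontier (Antichain-remove antiB B-x≢v)
                                            (Dominates-remove v∉A x∈B B-x≢v dom)

      a∈B-x : a ∈ B - x
      a∈B-x = subst (a ∈_) (sym B-x≡A) a∈A

      a∈B : a ∈ B
      a∈B = x∈p-y⇒x∈p B a∈B-x

    dominator≡ : ∀ {B} → Antichain E S′ B → Dominates E S′ B (A ∪ ⁅ v ⁆) → B ≡ A ∪ ⁅ v ⁆
    dominator≡ {B} antiB dom = begin
      B                ≡⟨ sym (p-x∪⁅x⁆≡p B v∈B) ⟩
      (B - v) ∪ ⁅ v ⁆  ≡⟨ cong (_∪ ⁅ v ⁆) B-v≡A ⟩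
      A ∪ ⁅ v ⁆        ∎
      where
      open ≡-Reasoning
      v∈B : v ∈ B
      v∈B = dominator-contains-sink antiB dom
      B-v≢v : ∀ b → b ∈ B - v → b ≢ v
      B-v≢v b = x∈p-y⇒x≢y B
      B-v≡A : B - v ≡ A
      B-v≡A = Frontier⇒dominating≡ frontier (Antichain-remove antiB B-v≢v)
                                            (Dominates-remove v∉A v∈B B-v≢v dom)

    Frontier-extend : (∀ a → a ∈ A → ¬ Reaches E S′ a v) → Frontier E S′ (A ∪ ⁅ v ⁆)
    Frontier-extend A↛v = Antichain-extend (proj₁ frontier) A↛v ,
                          λ B antiB B≢ dom → B≢ (dominator≡ antiB dom)

prefix-SinkExtension : ∀ {vtx : Fin n → Fin n} → IsTopOrder E vtx → (i : Fin n) →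
                       SinkExtension E (Prefix vtx (toℕ i)) (Prefix vtx (suc (toℕ i))) (vtx i)
prefix-SinkExtension {vtx = vtx} ((vtx-injective , _) , forward) i = record
  { extend   = λ { (j , refl , j<i) → j , refl , m<n⇒m<1+n j<i }
  ; sink∈    = i , refl , n<1+n (toℕ i)
  ; sink∉    = λ { (j , vj≡vi , j<i) → <-irrefl (cong toℕ (vtx-injective vj≡vi)) j<i }
  ; restrict = λ { (j , refl , s≤s j≤i) vj≢vi →
                   j , refl , ≤∧≢⇒< j≤i (vj≢vi ∘ cong vtx ∘ toℕ-injective) }
  ; no-out   = λ { vi→vj (j , refl , s≤s j≤i) → <-irrefl refl (≤-trans (forward i j vi→vj) j≤i) }
  }

lemma6 : (n : ℕ) (E : Graph n) (vtx : Fin n → Fin n) → IsTopOrder E vtx →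
         (i : Fin n) (A : Subset n) →
         Frontier E (Prefix vtx (toℕ i)) A →
         (∀ a → a ∈ A → ¬ Reaches E (Prefix vtx (suc (toℕ i))) a (vtx i)) →
         Frontier E (Prefix vtx (suc (toℕ i))) (A ∪ ⁅ vtx i ⁆)
lemma6 n E vtx top i A = Frontier-extend (prefix-SinkExtension top i)
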